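{- Let $n\ge 2$. For $2\le k\le n-1$, the second largest distinct adjacency eigenvalue of the enhanced hypercube $Q_{n,k}$ is $n-1$, so its adjacency spectral gap (largest minus second largest eigenvalue) is $2$. For $k=1$, the second largest distinct adjacency eigenvalue of $Q_{n,1}$ is $n-3$, so its adjacency spectral gap is $4$.
   Context: For $n\ge 2$ and $1\le k\le n-1$, the enhanced hypercube $Q_{n,k}$ is the simple graph whose vertices are the binary strings $x_1x_2\cdots x_n$ ($x_i\in\{0,1\}$), where $X=x_1\cdots x_n$ and $Y$ are adjacent iff either $Y$ is obtained from $X$ by complementing exactly one coordinate ($1\le i\le n$), or $Y=x_1\cdots x_{k-1}\overline{x_k}\,\overline{x_{k+1}}\cdots\overline{x_n}$. The graph is $(n+1)$-regular, so its largest adjacency eigenvalue is $n+1$. -}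

module Defs where

open import Level using (Level; _⊔_) renaming (suc to lsuc)
open import Data.Nat as ℕ using (ℕ; zero; suc; _∸_)
open import Data.Bool using (Bool; true; false; not)
open import Data.Bool.Properties using () renaming (_≟_ to _≟ᵇ_)
open import Data.Fin using (Fin; toℕ)
open import Data.Fin.Properties using (any?)
open import Data.Vec using (Vec; []; _∷_; _[_]%=_; tabulate; lookup)
open import Data.Vec.Properties using (≡-dec)
open import Data.List using (List; []; _∷_; _++_; map; foldr)
open import Data.Product using (∃; _×_; _,_)
open import Data.Sum using (_⊎_)
open import Relation.Binary using (Rel; IsTotalOrder)
open import Relation.Binary.PropositionalEquality using (_≡_)
open import Relation.Nullary using (¬_; Dec; yes; no)
open import Relation.Nullary.Decidable using (_⊎-dec_)
open import Algebra.Bundles using (CommutativeRing)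

-- Ordered fields (ℝ is one).  Eigenvalues are taken in an arbitrary
-- ordered field, so that the statement covers the real eigenvalues of
-- the (real symmetric) adjacency matrix.

record OrderedField (c ℓ₁ ℓ₂ : Level) : Set (lsuc (c ⊔ ℓ₁ ⊔ ℓ₂)) where
  field
    commutativeRing : CommutativeRing c ℓ₁
  open CommutativeRing commutativeRing public
  infix 4 _≤_
  field
    _≤_          : Rel Carrier ℓ₂
    isTotalOrder : IsTotalOrder _≈_ _≤_
    nontrivial   : ¬ (1# ≈ 0#)
    inverse      : ∀ x → ¬ (x ≈ 0#) → ∃ λ y → x * y ≈ 1#
    +-mono-≤     : ∀ {a b} c → a ≤ b → a + c ≤ b + c
    *-nonneg     : ∀ {a b} → 0# ≤ a → 0# ≤ b → 0# ≤ a * b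

  fromℕ : ℕ → Carrier
  fromℕ zero    = 0#
  fromℕ (suc m) = 1# + fromℕ m

-- vertices: binary strings x₁ ⋯ xₙ; coordinate i (1-based) is the
-- entry at index i-1 : Fin n.
Vertex : ℕ → Set
Vertex n = Vec Bool n

allVertices : (n : ℕ) → List (Vertex n)
allVertices zero    = [] ∷ []
allVertices (suc n) = map (false ∷_) (allVertices n) ++ map (true ∷_) (allVertices n)

flipAt : ∀ {n} → Fin n → Vertex n → Vertex n
flipAt i x = x [ i ]%= not

-- x₁ ⋯ x_{k-1} x̄_k x̄_{k+1} ⋯ x̄_n  (complement coordinates k..n, 1-based)
twist : ∀ {n} → ℕ → Vertex n → Vertex n
twist k x = tabulate λ j → complementIf (k ℕ.≤ᵇ suc (toℕ j)) (lookup x j)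
  where
  complementIf : Bool → Bool → Bool
  complementIf true  b = not b
  complementIf false b = b

Adjacent : (n k : ℕ) → Vertex n → Vertex n → Set
Adjacent n k x y = (∃ λ (i : Fin n) → y ≡ flipAt i x) ⊎ (y ≡ twist k x)

adjacent? : (n k : ℕ) → (x y : Vertex n) → Dec (Adjacent n k x y)
adjacent? n k x y =
  any? (λ i → ≡-dec _≟ᵇ_ y (flipAt i x)) ⊎-dec ≡-dec _≟ᵇ_ y (twist k x)

module Spectrum {c ℓ₁ ℓ₂} (F : OrderedField c ℓ₁ ℓ₂) (n k : ℕ) where
  open OrderedField F

  A : Vertex n → Vertex n → Carrier
  A x y with adjacent? n k x y
  ... | yes _ = 1#
  ... | no  _ = 0#

  sumOver : List (Vertex n) → (Vertex n → Carrier) → Carrier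
  sumOver ys f = foldr (λ y s → f y + s) 0# ys

  mulVec : (Vertex n → Carrier) → Vertex n → Carrier
  mulVec v x = sumOver (allVertices n) (λ y → A x y * v y)

  IsEigenvalue : Carrier → Set (c ⊔ ℓ₁)
  IsEigenvalue λ′ = ∃ λ (v : Vertex n → Carrier) →
    (∃ λ x → ¬ (v x ≈ 0#)) × (∀ x → mulVec v x ≈ λ′ * v x)

  IsLargestEigenvalue : Carrier → Set (c ⊔ ℓ₁ ⊔ ℓ₂)
  IsLargestEigenvalue λ₁ =
    IsEigenvalue λ₁ × (∀ μ → IsEigenvalue μ → μ ≤ λ₁)

  IsSecondLargestEigenvalue : Carrier → Set (c ⊔ ℓ₁ ⊔ ℓ₂)
  IsSecondLargestEigenvalue λ₂ = ∃ λ λ₁ →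
    IsLargestEigenvalue λ₁ × IsEigenvalue λ₂ × ¬ (λ₂ ≈ λ₁) ×
    (∀ μ → IsEigenvalue μ → ¬ (μ ≈ λ₁) → μ ≤ λ₂)

  HasSpectralGap : Carrier → Set (c ⊔ ℓ₁ ⊔ ℓ₂)
  HasSpectralGap g = ∃ λ λ₁ → ∃ λ λ₂ →
    IsLargestEigenvalue λ₁ × IsSecondLargestEigenvalue λ₂ × (λ₁ + - λ₂ ≈ g)

module Submission where

-- Q_{n,k} is the Cayley graph of ℤ₂ⁿ generated by the n unit vectors and
-- the mask p of the coordinates complemented by the twist, which has weight
-- ≥ 2 for 1 ≤ k ≤ n − 1.  Its eigenvectors are the characters
-- x ↦ (−1)^⟨ε·x⟩, with eigenvalues  Σᵢ (−1)^εᵢ + (−1)^⟨ε·p⟩ = n − 2|ε| ± 1.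
-- Over an ordered field we use this in the following form (Localisation):
-- splitting an eigenfunction coordinate by coordinate into components with
-- a fixed sign pattern shows that, if every character value is either l or
-- different from μ, then μ can only be an eigenvalue when μ = l.  Comparing
-- character values by weight, the largest eigenvalue is n + 1 (ε = 0), and
-- the second largest is n − 1 for k ≥ 2 (p₁ = 0, |ε| = 1) and n − 3 for
-- k = 1 (p = all ones, |ε| ∈ {1, 2}); the character of the first unit
-- vector realises both.

open import Defs
open import Algebra.Bundles using (CommutativeRing)
import Algebra.Solver.Ring.AlmostCommutativeRing as ACR
open import Data.Bool using (Bool; true; false; not; _xor_; _∧_; if_then_else_)
open import Data.Bool.Properties
  using (¬-not; ∧-zeroʳ; not-involutive; not-distribʳ-xor; xor-same; xor-inverseʳ)
open import Data.Fin using (Fin; toℕ; zero; suc; fromℕ<)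
open import Data.Fin.Properties using (toℕ-injective; toℕ<n; toℕ-fromℕ<)
open import Data.Integer as ℤ using (ℤ; +_; -[1+_]; _⊖_; _◃_; sign; ∣_∣)
import Data.Integer.Properties as ℤ
open import Data.List using (List; []; _∷_; _++_; map; foldr)
open import Data.Maybe using (Maybe; just; nothing)
open import Data.Nat as ℕ using (ℕ; zero; suc; _∸_)
import Data.Nat.Properties as ℕP
open import Data.Product using (∃; _,_; _×_)
open import Data.Sign as Sign using (Sign)
open import Data.Sum using (_⊎_; inj₁; inj₂)
open import Data.Vec using ([]; _∷_; tabulate; lookup; replicate)
open import Data.Vec.Functional using (updateAt)
open import Data.Vec.Functional.Properties using (updateAt-updates; updateAt-minimal)
open import Function using (_∘_)
open import Relation.Binary using (IsTotalOrder)
open import Relation.Binary.PropositionalEquality using (_≡_)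
import Relation.Binary.PropositionalEquality as ≡
open import Relation.Nullary using (¬_; yes; no; contradiction)

-- Every commutative ring receives a ring homomorphism from ℤ; it lets the
-- standard library's ring solver normalise expressions with integer
-- constants.  The constant n ≥ 2 is interpreted as 1# + (1# + ⋯ + 0#),
-- the recursion used by OrderedField.fromℕ, and 1 as 1#, so that the
-- solver's constants coincide definitionally with the ones in the goals.
module IntegerSolver {c ℓ} (R : CommutativeRing c ℓ) where
  open CommutativeRing R
  open import Algebra.Properties.Ring ring using (-‿involutive; -0#≈0#; -‿+-comm; -1*x≈-x)
  open import Algebra.Properties.CommutativeSemigroup *-commutativeSemigroup
    using () renaming (interchange to *-interchange)
  open import Relation.Binary.Reasoning.Setoid setoid

  cast : ℕ → Carrier
  cast zero    = 0#
  cast (suc m) = 1# + cast m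

  cast-+ : ∀ m n → cast (m ℕ.+ n) ≈ cast m + cast n
  cast-+ zero    n = sym (+-identityˡ _)
  cast-+ (suc m) n = trans (+-congˡ (cast-+ m n)) (sym (+-assoc _ _ _))

  cast-* : ∀ m n → cast (m ℕ.* n) ≈ cast m * cast n
  cast-* zero    n = sym (zeroˡ _)
  cast-* (suc m) n = begin
    cast (n ℕ.+ m ℕ.* n)          ≈⟨ cast-+ n (m ℕ.* n) ⟩
    cast n + cast (m ℕ.* n)       ≈⟨ +-cong (sym (*-identityˡ _)) (cast-* m n) ⟩
    1# * cast n + cast m * cast n ≈⟨ distribʳ _ _ _ ⟨
    (1# + cast m) * cast n        ∎

  ι : ℤ → Carrier
  ι (+ n)      = cast n
  ι -[1+ n ]   = - cast (suc n)

  ι-⊖ : ∀ m n → ι (m ⊖ n) ≈ cast m + - cast n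
  ι-⊖ zero    zero    = sym (trans (+-congˡ -0#≈0#) (+-identityʳ _))
  ι-⊖ zero    (suc n) = sym (+-identityˡ _)
  ι-⊖ (suc m) zero    = sym (trans (+-congˡ -0#≈0#) (+-identityʳ _))
  ι-⊖ (suc m) (suc n) = begin
    ι (suc m ⊖ suc n)                   ≡⟨ ≡.cong ι (ℤ.[1+m]⊖[1+n]≡m⊖n m n) ⟩
    ι (m ⊖ n)                           ≈⟨ ι-⊖ m n ⟩
    cast m + - cast n                   ≈⟨ +-congˡ (+-identityˡ _) ⟨
    cast m + (0# + - cast n)            ≈⟨ +-congˡ (+-congʳ (-‿inverseʳ 1#)) ⟨
    cast m + ((1# + - 1#) + - cast n)   ≈⟨ +-congˡ (+-assoc _ _ _) ⟩
    cast m + (1# + (- 1# + - cast n))   ≈⟨ +-assoc _ _ _ ⟨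
    (cast m + 1#) + (- 1# + - cast n)   ≈⟨ +-cong (+-comm _ _) (-‿+-comm _ _) ⟩
    (1# + cast m) + - (1# + cast n)     ∎

  ι-+ : ∀ i j → ι (i ℤ.+ j) ≈ ι i + ι j
  ι-+ (+ m)    (+ n)    = cast-+ m n
  ι-+ (+ m)    -[1+ n ] = ι-⊖ m (suc n)
  ι-+ -[1+ m ] (+ n)    = trans (ι-⊖ n (suc m)) (+-comm _ _)
  ι-+ -[1+ m ] -[1+ n ] = begin
    - cast (suc (suc (m ℕ.+ n)))        ≈⟨ -‿cong (+-congˡ (cast-+ (suc m) n)) ⟩
    - (1# + (cast (suc m) + cast n))    ≈⟨ -‿cong (+-assoc _ _ _) ⟨
    - ((1# + cast (suc m)) + cast n)    ≈⟨ -‿cong (+-congʳ (+-comm _ _)) ⟩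
    - ((cast (suc m) + 1#) + cast n)    ≈⟨ -‿cong (+-assoc _ _ _) ⟩
    - (cast (suc m) + cast (suc n))     ≈⟨ -‿+-comm _ _ ⟨
    - cast (suc m) + - cast (suc n)     ∎

  -- multiplicativity is checked on the sign/absolute-value decomposition
  signValue : Sign → Carrier
  signValue Sign.+ = 1#
  signValue Sign.- = - 1#

  ι-◃ : ∀ s n → ι (s ◃ n) ≈ signValue s * cast n
  ι-◃ s        zero    = sym (zeroʳ _)
  ι-◃ Sign.+   (suc n) = sym (*-identityˡ _)
  ι-◃ Sign.-   (suc n) = sym (-1*x≈-x _)

  ι-sign-abs : ∀ i → ι i ≈ signValue (sign i) * cast ∣ i ∣
  ι-sign-abs (+ n)    = sym (*-identityˡ _)
  ι-sign-abs -[1+ n ] = sym (-1*x≈-x _)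

  signValue-* : ∀ s t → signValue (s Sign.* t) ≈ signValue s * signValue t
  signValue-* Sign.+ t      = sym (*-identityˡ _)
  signValue-* Sign.- Sign.+ = sym (*-identityʳ _)
  signValue-* Sign.- Sign.- = sym (trans (-1*x≈-x _) (-‿involutive _))

  ι-* : ∀ i j → ι (i ℤ.* j) ≈ ι i * ι j
  ι-* i j = begin
    ι (sign i Sign.* sign j ◃ ∣ i ∣ ℕ.* ∣ j ∣)
      ≈⟨ ι-◃ (sign i Sign.* sign j) (∣ i ∣ ℕ.* ∣ j ∣) ⟩
    signValue (sign i Sign.* sign j) * cast (∣ i ∣ ℕ.* ∣ j ∣)
      ≈⟨ *-cong (signValue-* (sign i) (sign j)) (cast-* ∣ i ∣ ∣ j ∣) ⟩
    (signValue (sign i) * signValue (sign j)) * (cast ∣ i ∣ * cast ∣ j ∣)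
      ≈⟨ *-interchange _ _ _ _ ⟩
    (signValue (sign i) * cast ∣ i ∣) * (signValue (sign j) * cast ∣ j ∣)
      ≈⟨ *-cong (ι-sign-abs i) (ι-sign-abs j) ⟨
    ι i * ι j ∎

  ι-neg : ∀ i → ι (ℤ.- i) ≈ - ι i
  ι-neg (+ zero)  = sym -0#≈0#
  ι-neg (+ suc n) = refl
  ι-neg -[1+ n ]  = sym (-‿involutive _)

  -- the homomorphism actually handed to the solver: ι, but with 1 ↦ 1#
  literal : ℕ → Carrier
  literal (suc zero) = 1#
  literal n          = cast n

  constant : ℤ → Carrier
  constant (+ n)    = literal n
  constant -[1+ n ] = - literal (suc n)

  constant≈ι : ∀ i → constant i ≈ ι i
  constant≈ι (+ zero)          = refl
  constant≈ι (+ suc zero)      = sym (+-identityʳ _)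
  constant≈ι (+ suc (suc n))   = refl
  constant≈ι -[1+ zero ]       = -‿cong (sym (+-identityʳ _))
  constant≈ι -[1+ suc n ]      = refl

  ℤ⟶R : ACR._-Raw-AlmostCommutative⟶_ ℤ.+-*-rawRing (ACR.fromCommutativeRing R)
  ℤ⟶R = record
    { ⟦_⟧    = constant
    ; +-homo = λ i j → trans (constant≈ι (i ℤ.+ j)) (trans (ι-+ i j) (sym (+-cong (constant≈ι i) (constant≈ι j))))
    ; *-homo = λ i j → trans (constant≈ι (i ℤ.* j)) (trans (ι-* i j) (sym (*-cong (constant≈ι i) (constant≈ι j))))
    ; -‿homo = λ i → trans (constant≈ι (ℤ.- i)) (trans (ι-neg i) (sym (-‿cong (constant≈ι i))))
    ; 0-homo = refl
    ; 1-homo = refl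
    }

  ≟-constants : ∀ i j → Maybe (constant i ≈ constant j)
  ≟-constants i j with i ℤ.≟ j
  ... | yes ≡.refl = just refl
  ... | no _       = nothing

  open import Algebra.Solver.Ring ℤ.+-*-rawRing (ACR.fromCommutativeRing R) ℤ⟶R ≟-constants public


-- A mask p : Fin n → Bool is a vector of ℤ₂ⁿ; x ⊕ p
-- complements the coordinates selected by p.  Q_{n,k} is the Cayley graph
-- of ℤ₂ⁿ for the unit vectors and the single further mask twistMask k.

Mask : ℕ → Set
Mask n = Fin n → Bool

infixl 6 _⊕_
_⊕_ : ∀ {n} → Vertex n → Mask n → Vertex n
x ⊕ p = tabulate λ j → p j xor lookup x j

twistMask : ∀ {n} → ℕ → Mask n
twistMask k j = k ℕ.≤ᵇ suc (toℕ j)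

twist≡⊕ : ∀ {n} k (x : Vertex n) → twist k x ≡ x ⊕ twistMask k
twist≡⊕ k             []      = ≡.refl
twist≡⊕ zero          (b ∷ x) = ≡.cong (not b ∷_) (twist≡⊕ zero x)
twist≡⊕ (suc zero)    (b ∷ x) = ≡.cong (not b ∷_) (twist≡⊕ 1 x)
twist≡⊕ (suc (suc k)) (b ∷ x) = ≡.cong (b ∷_) (twist≡⊕ (suc k) x)

flipAt-involutive : ∀ {n} (i : Fin n) x → flipAt i (flipAt i x) ≡ x
flipAt-involutive zero    (b ∷ x) = ≡.cong (_∷ x) (not-involutive b)
flipAt-involutive (suc i) (b ∷ x) = ≡.cong (b ∷_) (flipAt-involutive i x)

flipAt-comm : ∀ {n} (i j : Fin n) x → flipAt i (flipAt j x) ≡ flipAt j (flipAt i x)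
flipAt-comm zero    zero    x       = ≡.refl
flipAt-comm zero    (suc j) (b ∷ x) = ≡.refl
flipAt-comm (suc i) zero    (b ∷ x) = ≡.refl
flipAt-comm (suc i) (suc j) (b ∷ x) = ≡.cong (b ∷_) (flipAt-comm i j x)

flipAt-⊕ : ∀ {n} (i : Fin n) x p → flipAt i x ⊕ p ≡ flipAt i (x ⊕ p)
flipAt-⊕ zero    (b ∷ x) p = ≡.cong (_∷ x ⊕ (p ∘ suc)) (≡.sym (not-distribʳ-xor (p zero) b))
flipAt-⊕ (suc i) (b ∷ x) p = ≡.cong (_ ∷_) (flipAt-⊕ i x (p ∘ suc))

weight : ∀ {n} → Mask n → ℕ
weight {zero}  p = 0
weight {suc n} p = (if p zero then 1 else 0) ℕ.+ weight (p ∘ suc)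

twistMask-weight : ∀ n k → 1 ℕ.≤ k → k ℕ.≤ n ∸ 1 → 2 ℕ.≤ weight (twistMask {n} k)
twistMask-weight n             1             _ k≤n-1 =
  ≡.subst (2 ℕ.≤_) (≡.sym (all-selected n)) (2≤n n k≤n-1)
  where
  all-selected : ∀ n → weight (twistMask {n} 1) ≡ n
  all-selected zero    = ≡.refl
  all-selected (suc n) = ≡.cong suc (all-selected n)
  2≤n : ∀ n → 1 ℕ.≤ n ∸ 1 → 2 ℕ.≤ n
  2≤n (suc (suc n)) _ = ℕ.s≤s (ℕ.s≤s ℕ.z≤n)
twistMask-weight (suc (suc n)) (suc (suc k)) _ (ℕ.s≤s k≤n) =
  twistMask-weight (suc n) (suc k) (ℕ.s≤s ℕ.z≤n) k≤n

⟨_·_⟩ : ∀ {n} → Mask n → Mask n → Bool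
⟨_·_⟩ {zero}  ε p = false
⟨_·_⟩ {suc n} ε p = (p zero ∧ ε zero) xor ⟨ ε ∘ suc · p ∘ suc ⟩

pairing-weight0 : ∀ {n} (ε p : Mask n) → weight ε ≡ 0 → ⟨ ε · p ⟩ ≡ false
pairing-weight0 {zero}  ε p w≡0 = ≡.refl
pairing-weight0 {suc n} ε p w≡0 with ε zero
... | false rewrite ∧-zeroʳ (p zero) = pairing-weight0 (ε ∘ suc) (p ∘ suc) w≡0

odd : ℕ → Bool
odd zero    = false
odd (suc m) = not (odd m)

-- the all-ones mask; it is twistMask 1
ones : ∀ {n} → Mask n
ones _ = true

pairing-ones : ∀ {n} (ε : Mask n) → ⟨ ε · ones ⟩ ≡ odd (weight ε)
pairing-ones {zero}  ε = ≡.refl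
pairing-ones {suc n} ε with ε zero
... | false = pairing-ones (ε ∘ suc)
... | true  = ≡.cong not (pairing-ones (ε ∘ suc))

-- Boolean tests for the two kinds of adjacency; they let the sums in the
-- adjacency operator be evaluated by recursion on the vertex.
same? : ∀ {n} → Vertex n → Vertex n → Bool
same? []      []      = true
same? (b ∷ x) (c ∷ y) = not (b xor c) ∧ same? x y

oneFlipApart? : ∀ {n} → Vertex n → Vertex n → Bool
oneFlipApart? []      []      = false
oneFlipApart? (b ∷ x) (c ∷ y) = if b xor c then same? x y else oneFlipApart? x y

same?-refl : ∀ {n} (x : Vertex n) → same? x x ≡ true
same?-refl []          = ≡.refl
same?-refl (true  ∷ x) = same?-refl x
same?-refl (false ∷ x) = same?-refl x

same?-sound : ∀ {n} (x y : Vertex n) → same? x y ≡ true → x ≡ y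
same?-sound []          []          _ = ≡.refl
same?-sound (true  ∷ x) (true  ∷ y) e = ≡.cong (true ∷_)  (same?-sound x y e)
same?-sound (false ∷ x) (false ∷ y) e = ≡.cong (false ∷_) (same?-sound x y e)

oneFlipApart?-sound : ∀ {n} (x y : Vertex n) → oneFlipApart? x y ≡ true → ∃ λ i → y ≡ flipAt i x
oneFlipApart?-sound []          []          ()
oneFlipApart?-sound (true ∷ x) (false ∷ y) e = zero , ≡.cong (false ∷_) (≡.sym (same?-sound x y e))
oneFlipApart?-sound (false ∷ x) (true ∷ y) e = zero , ≡.cong (true ∷_)  (≡.sym (same?-sound x y e))
oneFlipApart?-sound (true ∷ x) (true ∷ y) e =
  let i , y≡ = oneFlipApart?-sound x y e in suc i , ≡.cong (true ∷_) y≡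
oneFlipApart?-sound (false ∷ x) (false ∷ y) e =
  let i , y≡ = oneFlipApart?-sound x y e in suc i , ≡.cong (false ∷_) y≡

oneFlipApart?-complete : ∀ {n} (i : Fin n) x → oneFlipApart? x (flipAt i x) ≡ true
oneFlipApart?-complete zero    (true  ∷ x) = same?-refl x
oneFlipApart?-complete zero    (false ∷ x) = same?-refl x
oneFlipApart?-complete (suc i) (true  ∷ x) = oneFlipApart?-complete i x
oneFlipApart?-complete (suc i) (false ∷ x) = oneFlipApart?-complete i x

same?-⊕ : ∀ {n} (x : Vertex n) p → same? x (x ⊕ p) ≡ true → weight p ≡ 0
same?-⊕ []      p e = ≡.refl
same?-⊕ (b ∷ x) p e with p zero
... | false = same?-⊕ x (p ∘ suc) (≡.subst (λ t → not t ∧ _ ≡ true) (xor-same b) e)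
... | true  = contradiction (≡.subst (λ t → not t ∧ _ ≡ true) (xor-inverseʳ b) e) λ ()

oneFlipApart?-⊕ : ∀ {n} (x : Vertex n) p → oneFlipApart? x (x ⊕ p) ≡ true → weight p ≡ 1
oneFlipApart?-⊕ (b ∷ x) p e with p zero
... | false = oneFlipApart?-⊕ x (p ∘ suc) (≡.subst (λ t → (if t then _ else _) ≡ true) (xor-same b) e)
... | true  = ≡.cong suc (same?-⊕ x (p ∘ suc) (≡.subst (λ t → (if t then _ else _) ≡ true) (xor-inverseʳ b) e))

⊕-not-oneFlipApart : ∀ {n} (p : Mask n) → 2 ℕ.≤ weight p → ∀ x → oneFlipApart? x (x ⊕ p) ≡ false
⊕-not-oneFlipApart p 2≤w x with oneFlipApart? x (x ⊕ p) in e
... | false = ≡.refl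
... | true  = contradiction (oneFlipApart?-⊕ x p e) λ w≡1 → ℕP.<-irrefl (≡.sym w≡1) 2≤w

module OrderedFieldFacts {c ℓ₁ ℓ₂} (F : OrderedField c ℓ₁ ℓ₂) where
  open OrderedField F
  open IntegerSolver commutativeRing public using (solve; _:+_; _:*_; _:-_; :-_; con; _:=_)
  open import Algebra.Properties.Ring ring using (x∙y⁻¹≈ε⇒x≈y)
  open import Relation.Binary.Reasoning.Setoid setoid
  module ≤ = IsTotalOrder isTotalOrder

  0≤-+ : ∀ {a b} → 0# ≤ a → 0# ≤ b → 0# ≤ a + b
  0≤-+ {a} {b} 0≤a 0≤b = ≤.trans 0≤b (≤.trans (≤.reflexive (sym (+-identityˡ b))) (+-mono-≤ b 0≤a))

  ≤-by : ∀ {a b} d → 0# ≤ d → a + d ≈ b → a ≤ b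
  ≤-by {a} d 0≤d a+d≈b =
    ≤.trans (≤.reflexive (sym (+-identityˡ a))) (≤.trans (+-mono-≤ a 0≤d) (≤.reflexive (trans (+-comm d a) a+d≈b)))

  -- 1 is positive since, otherwise, 0 ≤ (-1)(-1) = 1
  0≤1 : 0# ≤ 1#
  0≤1 with ≤.total 0# 1#
  ... | inj₁ 0≤1 = 0≤1
  ... | inj₂ 1≤0 = ≤.trans (*-nonneg 0≤-1 0≤-1) (≤.reflexive (solve 0 (con -[1+ 0 ] :* con -[1+ 0 ] := con (+ 1)) refl))
    where
    0≤-1 : 0# ≤ - 1#
    0≤-1 = ≤.trans (≤.reflexive (sym (-‿inverseʳ 1#))) (≤.trans (+-mono-≤ (- 1#) 1≤0) (≤.reflexive (+-identityˡ _)))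

  fromℕ-+ : ∀ m n → fromℕ (m ℕ.+ n) ≈ fromℕ m + fromℕ n
  fromℕ-+ zero    n = sym (+-identityˡ _)
  fromℕ-+ (suc m) n = trans (+-congˡ (fromℕ-+ m n)) (sym (+-assoc _ _ _))

  ≤-shift : ∀ {a b b′} d e → a + d ≤ b → b + (e + - d) ≈ b′ → a + e ≤ b′
  ≤-shift {a} {b} {b′} d e a+d≤b b′≈ =
    ≤.trans (≤.reflexive shift) (≤.trans (+-mono-≤ (e + - d) a+d≤b) (≤.reflexive b′≈))
    where
    shift : a + e ≈ (a + d) + (e + - d)
    shift = solve 3 (λ a d e → a :+ e := (a :+ d) :+ (e :- d)) refl a d e

  0≤fromℕ : ∀ m → 0# ≤ fromℕ m
  0≤fromℕ zero    = ≤.refl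
  0≤fromℕ (suc m) = 0≤-+ 0≤1 (0≤fromℕ m)

  fromℕ-suc≉0 : ∀ m → ¬ (fromℕ (suc m) ≈ 0#)
  fromℕ-suc≉0 m 1+m≈0 = nontrivial (≤.antisym 1≤0 0≤1)
    where
    1≤0 : 1# ≤ 0#
    1≤0 = ≤.trans (≤-by (fromℕ m) (0≤fromℕ m) refl) (≤.reflexive 1+m≈0)

  apart : ∀ {a μ} → a + fromℕ 2 ≤ μ → ¬ (μ ≈ a)
  apart {a} {μ} a+2≤μ μ≈a = fromℕ-suc≉0 1 (≤.antisym 2≤0 (0≤fromℕ 2))
    where
    2≤0 : fromℕ 2 ≤ 0#
    2≤0 = ≤.trans (≤.reflexive (solve 1 (λ a → con (+ 2) := (a :+ con (+ 2)) :- a) refl a))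
            (≤.trans (+-mono-≤ (- a) a+2≤μ) (≤.reflexive (trans (+-congʳ μ≈a) (-‿inverseʳ a))))

  cancel-nonzero : ∀ {a b} → ¬ (a ≈ 0#) → a * b ≈ 0# → b ≈ 0#
  cancel-nonzero {a} {b} a≉0 ab≈0 with inverse a a≉0
  ... | a⁻¹ , aa⁻¹≈1 = begin
    b              ≈⟨ *-identityˡ b ⟨
    1# * b         ≈⟨ *-congʳ aa⁻¹≈1 ⟨
    (a * a⁻¹) * b  ≈⟨ solve 3 (λ a a⁻¹ b → (a :* a⁻¹) :* b := a⁻¹ :* (a :* b)) refl a a⁻¹ b ⟩
    a⁻¹ * (a * b)  ≈⟨ *-congˡ ab≈0 ⟩
    a⁻¹ * 0#       ≈⟨ zeroʳ a⁻¹ ⟩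
    0#             ∎

  difference≈0⇒≈ : ∀ {a b} → a + - b ≈ 0# → a ≈ b
  difference≈0⇒≈ {a} {b} = x∙y⁻¹≈ε⇒x≈y a b

  difference≉0 : ∀ {a b} → ¬ (a ≈ b) → ¬ (a + - b ≈ 0#)
  difference≉0 a≉b a-b≈0 = a≉b (difference≈0⇒≈ a-b≈0)

  gap⇒≉ : ∀ {l₁ l₂} m → l₁ + - l₂ ≈ fromℕ (suc m) → ¬ (l₂ ≈ l₁)
  gap⇒≉ {l₁} {l₂} m gap l₂≈l₁ =
    fromℕ-suc≉0 m (trans (sym gap) (trans (+-congʳ (sym l₂≈l₁)) (-‿inverseʳ l₂)))

module CubeAnalysis {c ℓ₁ ℓ₂} (F : OrderedField c ℓ₁ ℓ₂) where
  open OrderedField F hiding (zero)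
  open OrderedFieldFacts F
  open import Algebra.Properties.Semiring.Sum semiring
    using (sum-syntax; sum-cong-≋; ∑-distrib-+; *-distribˡ-sum; *-distribʳ-sum)
  open import Relation.Binary.Reasoning.Setoid setoid

  Fun : ℕ → Set c
  Fun n = Vertex n → Carrier

  𝟙 : Bool → Carrier
  𝟙 true  = 1#
  𝟙 false = 0#

  Σ⟨_⟩ : ∀ {n} → List (Vertex n) → Fun n → Carrier
  Σ⟨ ys ⟩ f = foldr (λ y s → f y + s) 0# ys

  Σ-cong : ∀ {n} (ys : List (Vertex n)) {f g : Fun n} → (∀ y → f y ≈ g y) → Σ⟨ ys ⟩ f ≈ Σ⟨ ys ⟩ g
  Σ-cong []       f≈g = refl
  Σ-cong (y ∷ ys) f≈g = +-cong (f≈g y) (Σ-cong ys f≈g)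

  Σ-+ : ∀ {n} (ys : List (Vertex n)) (f g : Fun n) → Σ⟨ ys ⟩ (λ y → f y + g y) ≈ Σ⟨ ys ⟩ f + Σ⟨ ys ⟩ g
  Σ-+ []       f g = sym (+-identityˡ 0#)
  Σ-+ (y ∷ ys) f g = trans (+-congˡ (Σ-+ ys f g))
    (solve 4 (λ a b c d → (a :+ b) :+ (c :+ d) := (a :+ c) :+ (b :+ d)) refl (f y) (g y) _ _)

  Σ-zero : ∀ {n} (ys : List (Vertex n)) {f : Fun n} → (∀ y → f y ≈ 0#) → Σ⟨ ys ⟩ f ≈ 0#
  Σ-zero ys f≈0 = trans (Σ-cong ys f≈0) (zeros ys)
    where
    zeros : ∀ ys → Σ⟨ ys ⟩ (λ _ → 0#) ≈ 0#
    zeros []       = refl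
    zeros (y ∷ ys) = trans (+-identityˡ _) (zeros ys)

  Σ-++ : ∀ {n} (ys zs : List (Vertex n)) f → Σ⟨ ys ++ zs ⟩ f ≈ Σ⟨ ys ⟩ f + Σ⟨ zs ⟩ f
  Σ-++ []       zs f = sym (+-identityˡ _)
  Σ-++ (y ∷ ys) zs f = trans (+-congˡ (Σ-++ ys zs f)) (sym (+-assoc _ _ _))

  Σ-map : ∀ {m n} (g : Vertex m → Vertex n) ys f → Σ⟨ map g ys ⟩ f ≡ Σ⟨ ys ⟩ (f ∘ g)
  Σ-map g []       f = ≡.refl
  Σ-map g (y ∷ ys) f = ≡.cong (λ s → f (g y) + s) (Σ-map g ys f)

  Σ-cube : ∀ {n} (f : Fun (suc n)) →
    Σ⟨ allVertices (suc n) ⟩ f ≈ Σ⟨ allVertices n ⟩ (f ∘ (false ∷_)) + Σ⟨ allVertices n ⟩ (f ∘ (true ∷_))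
  Σ-cube {n} f = begin
    Σ⟨ map (false ∷_) (allVertices n) ++ map (true ∷_) (allVertices n) ⟩ f
      ≈⟨ Σ-++ (map (false ∷_) (allVertices n)) _ f ⟩
    Σ⟨ map (false ∷_) (allVertices n) ⟩ f + Σ⟨ map (true ∷_) (allVertices n) ⟩ f
      ≡⟨ ≡.cong₂ _+_ (Σ-map (false ∷_) (allVertices n) f) (Σ-map (true ∷_) (allVertices n) f) ⟩
    Σ⟨ allVertices n ⟩ (f ∘ (false ∷_)) + Σ⟨ allVertices n ⟩ (f ∘ (true ∷_)) ∎

  Σ-same? : ∀ {n} (z : Vertex n) (v : Fun n) → Σ⟨ allVertices n ⟩ (λ y → 𝟙 (same? z y) * v y) ≈ v z
  Σ-same? []              v = trans (+-identityʳ _) (*-identityˡ _)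
  Σ-same? {suc n} (false ∷ z) v = trans (Σ-cube (λ y → 𝟙 (same? (false ∷ z) y) * v y))
    (trans (+-cong (Σ-same? z (v ∘ (false ∷_))) (Σ-zero (allVertices n) (λ y → zeroˡ _))) (+-identityʳ _))
  Σ-same? {suc n} (true ∷ z)  v = trans (Σ-cube (λ y → 𝟙 (same? (true ∷ z) y) * v y))
    (trans (+-cong (Σ-zero (allVertices n) (λ y → zeroˡ _)) (Σ-same? z (v ∘ (true ∷_)))) (+-identityˡ _))

  neighbourSum : ∀ {n} → Fun n → Vertex n → Carrier
  neighbourSum {n} v x = ∑[ i < n ] v (flipAt i x)

  Σ-oneFlipApart? : ∀ {n} (x : Vertex n) (v : Fun n) →
    Σ⟨ allVertices n ⟩ (λ y → 𝟙 (oneFlipApart? x y) * v y) ≈ neighbourSum v x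
  Σ-oneFlipApart? []          v = trans (+-identityʳ _) (zeroˡ _)
  Σ-oneFlipApart? (false ∷ x) v = trans (Σ-cube (λ y → 𝟙 (oneFlipApart? (false ∷ x) y) * v y))
    (trans (+-cong (Σ-oneFlipApart? x (v ∘ (false ∷_))) (Σ-same? x (v ∘ (true ∷_)))) (+-comm _ _))
  Σ-oneFlipApart? (true ∷ x)  v = trans (Σ-cube (λ y → 𝟙 (oneFlipApart? (true ∷ x) y) * v y))
    (+-cong (Σ-same? x (v ∘ (false ∷_))) (Σ-oneFlipApart? x (v ∘ (true ∷_))))

  neighbourSum-constant : ∀ {n} a (x : Vertex n) → neighbourSum (λ _ → a) x ≈ fromℕ n * a
  neighbourSum-constant a []      = sym (zeroˡ a)
  neighbourSum-constant a (b ∷ x) = trans (+-congˡ (neighbourSum-constant a x))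
    (solve 2 (λ a N → a :+ N :* a := (con (+ 1) :+ N) :* a) refl a _)

  neighbourSum-signed : ∀ {n} (s : Fin n → Carrier) (w : Fun n) →
    (∀ i y → w (flipAt i y) ≈ s i * w y) → ∀ x → neighbourSum w x ≈ (∑[ i < n ] s i) * w x
  neighbourSum-signed s w moves x = trans (sum-cong-≋ (λ i → moves i x)) (sym (*-distribʳ-sum (w x) s))

  IsEigenfunction : ∀ {n} → Carrier → Mask n → Fun n → Set ℓ₁
  IsEigenfunction μ p w = ∀ x → μ * w x ≈ neighbourSum w x + w (x ⊕ p)

  eigen-resp : ∀ {n μ μ′ p} {w : Fun n} → μ ≈ μ′ → IsEigenfunction μ p w → IsEigenfunction μ′ p w
  eigen-resp μ≈μ′ eig x = trans (*-congʳ (sym μ≈μ′)) (eig x)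

  eigen-translate : ∀ {n μ p} {w : Fun n} → IsEigenfunction μ p w → ∀ i → IsEigenfunction μ p (w ∘ flipAt i)
  eigen-translate {μ = μ} {p} {w} eig i x = begin
    μ * w (flipAt i x)                                 ≈⟨ eig (flipAt i x) ⟩
    neighbourSum w (flipAt i x) + w (flipAt i x ⊕ p)   ≈⟨ +-cong (sum-cong-≋ λ j → reflexive (≡.cong w (flipAt-comm i j x)))
                                                                  (reflexive (≡.cong w (≡.sym (flipAt-⊕ i x p)))) ⟨
    neighbourSum (w ∘ flipAt i) x + w (flipAt i (x ⊕ p)) ∎

  eigen-combine : ∀ {n μ p} {w w′ : Fun n} → IsEigenfunction μ p w → IsEigenfunction μ p w′ →
    ∀ a → IsEigenfunction μ p (λ y → w y + a * w′ y)
  eigen-combine {μ = μ} {p} {w} {w′} eig eig′ a x = begin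
    μ * (w x + a * w′ x)
      ≈⟨ solve 4 (λ m a u v → m :* (u :+ a :* v) := m :* u :+ a :* (m :* v)) refl μ a (w x) (w′ x) ⟩
    μ * w x + a * (μ * w′ x)
      ≈⟨ +-cong (eig x) (*-congˡ (eig′ x)) ⟩
    (neighbourSum w x + w (x ⊕ p)) + a * (neighbourSum w′ x + w′ (x ⊕ p))
      ≈⟨ solve 5 (λ a N u N′ u′ → (N :+ u) :+ a :* (N′ :+ u′) := (N :+ a :* N′) :+ (u :+ a :* u′))
               refl a (neighbourSum w x) (w (x ⊕ p)) (neighbourSum w′ x) (w′ (x ⊕ p)) ⟩
    (neighbourSum w x + a * neighbourSum w′ x) + (w (x ⊕ p) + a * w′ (x ⊕ p))
      ≈⟨ +-congʳ (+-congˡ (*-distribˡ-sum a (λ i → w′ (flipAt i x)))) ⟩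
    (neighbourSum w x + neighbourSum (λ y → a * w′ y) x) + (w (x ⊕ p) + a * w′ (x ⊕ p))
      ≈⟨ +-congʳ (∑-distrib-+ (λ i → w (flipAt i x)) (λ i → a * w′ (flipAt i x))) ⟨
    neighbourSum (λ y → w y + a * w′ y) x + (w (x ⊕ p) + a * w′ (x ⊕ p)) ∎

  sgn : Bool → Carrier
  sgn false = 1#
  sgn true  = - 1#

  sgn-xor : ∀ a b → sgn (a xor b) ≈ sgn a * sgn b
  sgn-xor false b     = sym (*-identityˡ _)
  sgn-xor true  false = sym (*-identityʳ _)
  sgn-xor true  true  = solve 0 (con (+ 1) := con -[1+ 0 ] :* con -[1+ 0 ]) refl

  sgn-square : ∀ b → sgn b * sgn b ≈ 1#
  sgn-square b = trans (sym (sgn-xor b b)) (reflexive (≡.cong sgn (xor-same b)))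

  HasSigns : ∀ {n} → Mask n → Fun n → Set ℓ₁
  HasSigns ε w = ∀ i y → w (flipAt i y) ≈ sgn (ε i) * w y

  HasSigns-⊕ : ∀ {n} {ε : Mask n} {w} → HasSigns ε w → ∀ p x → w (x ⊕ p) ≈ sgn ⟨ ε · p ⟩ * w x
  HasSigns-⊕ {zero}          signs p []      = sym (*-identityˡ _)
  HasSigns-⊕ {suc n} {ε} {w} signs p (b ∷ x) = begin
    w ((p zero xor b) ∷ x ⊕ (p ∘ suc))             ≈⟨ HasSigns-⊕ (λ i y → signs (suc i) (_ ∷ y)) (p ∘ suc) x ⟩
    s′ * w ((p zero xor b) ∷ x)                   ≈⟨ *-congˡ (first-coordinate (p zero)) ⟩
    s′ * (sgn (p zero ∧ ε zero) * w (b ∷ x))      ≈⟨ solve 3 (λ a b c → a :* (b :* c) := (b :* a) :* c) refl _ _ _ ⟩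
    (sgn (p zero ∧ ε zero) * s′) * w (b ∷ x)      ≈⟨ *-congʳ (sgn-xor (p zero ∧ ε zero) _) ⟨
    sgn ⟨ ε · p ⟩ * w (b ∷ x)                     ∎
    where
    s′ : Carrier
    s′ = sgn ⟨ ε ∘ suc · p ∘ suc ⟩
    first-coordinate : ∀ q → w ((q xor b) ∷ x) ≈ sgn (q ∧ ε zero) * w (b ∷ x)
    first-coordinate false = sym (*-identityˡ _)
    first-coordinate true  = signs zero (b ∷ x)

  charValue : ∀ {n} → Mask n → Mask n → Carrier
  charValue {n} p ε = ∑[ i < n ] sgn (ε i) + sgn ⟨ ε · p ⟩

  HasSigns-eigenvalue : ∀ {n μ p ε} {w : Fun n} → HasSigns ε w → IsEigenfunction μ p w →
    ∀ x → (μ + - charValue p ε) * w x ≈ 0#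
  HasSigns-eigenvalue {n} {μ} {p} {ε} {w} signs eig x = begin
    (μ + - (S + t)) * w x                          ≈⟨ distribʳ _ _ _ ⟩
    μ * w x + - (S + t) * w x                      ≈⟨ +-congʳ (eig x) ⟩
    (neighbourSum w x + w (x ⊕ p)) + - (S + t) * w x
      ≈⟨ +-congʳ (+-cong (neighbourSum-signed _ w signs x) (HasSigns-⊕ signs p x)) ⟩
    (S * w x + t * w x) + - (S + t) * w x          ≈⟨ solve 3 (λ S t a → (S :* a :+ t :* a) :+ (:- (S :+ t)) :* a := con (+ 0))
                                                            refl S t (w x) ⟩
    0#                                             ∎
    where
    S t : Carrier
    S = ∑[ i < n ] sgn (ε i)
    t = sgn ⟨ ε · p ⟩

  SignedBelow : ∀ {n} → ℕ → Mask n → Fun n → Set ℓ₁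
  SignedBelow m ε w = ∀ i → toℕ i ℕ.< m → ∀ y → w (flipAt i y) ≈ sgn (ε i) * w y

  split : ∀ {n} → Bool → Fin n → Fun n → Fun n
  split σ i w y = w y + sgn σ * w (flipAt i y)

  split-recombine : ∀ {n} i (w : Fun n) y → split false i w y + split true i w y ≈ fromℕ 2 * w y
  split-recombine i w y = solve 2 (λ a b → (a :+ con (+ 1) :* b) :+ (a :+ con -[1+ 0 ] :* b) := con (+ 2) :* a)
                                refl (w y) (w (flipAt i y))

  split-sign : ∀ {n} σ i (w : Fun n) y → split σ i w (flipAt i y) ≈ sgn σ * split σ i w y
  split-sign σ i w y = begin
    w (flipAt i y) + sgn σ * w (flipAt i (flipAt i y))
      ≡⟨ ≡.cong (λ z → w (flipAt i y) + sgn σ * w z) (flipAt-involutive i y) ⟩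
    w (flipAt i y) + sgn σ * w y                       ≈⟨ +-congʳ (*-identityˡ _) ⟨
    1# * w (flipAt i y) + sgn σ * w y                  ≈⟨ +-congʳ (*-congʳ (sgn-square σ)) ⟨
    (sgn σ * sgn σ) * w (flipAt i y) + sgn σ * w y
      ≈⟨ solve 3 (λ s a b → (s :* s) :* b :+ s :* a := s :* (a :+ s :* b)) refl (sgn σ) (w y) (w (flipAt i y)) ⟩
    sgn σ * split σ i w y ∎

  split-keeps : ∀ {n} σ i j (w : Fun n) s → (∀ y → w (flipAt j y) ≈ s * w y) →
    ∀ y → split σ i w (flipAt j y) ≈ s * split σ i w y
  split-keeps σ i j w s move y = begin
    w (flipAt j y) + sgn σ * w (flipAt i (flipAt j y))
      ≡⟨ ≡.cong (λ z → w (flipAt j y) + sgn σ * w z) (flipAt-comm i j y) ⟩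
    w (flipAt j y) + sgn σ * w (flipAt j (flipAt i y)) ≈⟨ +-cong (move y) (*-congˡ (move (flipAt i y))) ⟩
    s * w y + sgn σ * (s * w (flipAt i y))
      ≈⟨ solve 4 (λ s t a b → s :* a :+ t :* (s :* b) := s :* (a :+ t :* b)) refl s (sgn σ) (w y) (w (flipAt i y)) ⟩
    s * split σ i w y ∎

  SignedBelow-split : ∀ {n m ε} {w : Fun n} σ i → toℕ i ≡ m → SignedBelow m ε w →
    SignedBelow (suc m) (updateAt ε i (λ _ → σ)) (split σ i w)
  SignedBelow-split {ε = ε} {w} σ i i≡m signed j j<1+m y with ℕP.m<1+n⇒m<n∨m≡n j<1+m
  ... | inj₂ j≡m rewrite toℕ-injective {i = j} {j = i} (≡.trans j≡m (≡.sym i≡m)) | updateAt-updates i {λ _ → σ} ε =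
    split-sign σ i w y
  ... | inj₁ j<m
    rewrite updateAt-minimal j i {λ _ → σ} ε (λ j≡i → ℕP.<-irrefl (≡.trans (≡.cong toℕ j≡i) i≡m) j<m) =
    split-keeps σ i j w (sgn (ε j)) (signed j j<m) y

  -- Localisation of eigenvalues: if every character value is either l or
  -- different from μ, then μ can only be an eigenvalue if μ = l.  Splitting
  -- an eigenfunction coordinate by coordinate into components with a fixed
  -- sign pattern reduces this to HasSigns-eigenvalue.
  module Localisation {n} (p : Mask n) (μ l : Carrier)
           (separated : ∀ ε → charValue p ε ≈ l ⊎ ¬ (μ ≈ charValue p ε)) where

    annihilate-signed : ∀ {ε} {w : Fun n} → HasSigns ε w → IsEigenfunction μ p w → ∀ x → (μ + - l) * w x ≈ 0#
    annihilate-signed {ε} signs eig x with separated ε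
    ... | inj₁ c≈l = trans (*-congʳ (+-congˡ (-‿cong (sym c≈l)))) (HasSigns-eigenvalue signs eig x)
    ... | inj₂ μ≉c = trans (*-congˡ (cancel-nonzero (difference≉0 μ≉c) (HasSigns-eigenvalue signs eig x))) (zeroʳ _)

    -- induction on the number r of coordinates whose sign is not yet fixed
    annihilate : ∀ r {m ε} {w : Fun n} → r ℕ.+ m ≡ n → SignedBelow m ε w → IsEigenfunction μ p w →
      ∀ x → (μ + - l) * w x ≈ 0#
    annihilate zero {ε = ε} ≡.refl signed eig = annihilate-signed {ε = ε} (λ i → signed i (toℕ<n i)) eig
    annihilate (suc r) {m} {ε} {w} 1+r+m≡n signed eig x = cancel-nonzero (fromℕ-suc≉0 1) (begin
      fromℕ 2 * ((μ + - l) * w x)                                ≈⟨ solve 3 (λ a b c → a :* (b :* c) := b :* (a :* c)) refl _ _ _ ⟩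
      (μ + - l) * (fromℕ 2 * w x)                                ≈⟨ *-congˡ (split-recombine i w x) ⟨
      (μ + - l) * (split false i w x + split true i w x)         ≈⟨ distribˡ _ _ _ ⟩
      (μ + - l) * split false i w x + (μ + - l) * split true i w x ≈⟨ +-cong (component false) (component true) ⟩
      0# + 0#                                                     ≈⟨ +-identityʳ 0# ⟩
      0#                                                          ∎)
      where
      m<n : m ℕ.< n
      m<n = ≡.subst (m ℕ.<_) 1+r+m≡n (ℕ.s≤s (ℕP.m≤n+m m r))
      i : Fin n
      i = fromℕ< m<n
      component : ∀ σ → (μ + - l) * split σ i w x ≈ 0#
      component σ = annihilate r {ε = updateAt ε i (λ _ → σ)} (≡.trans (ℕP.+-suc r m) 1+r+m≡n)
        (SignedBelow-split {ε = ε} σ i (toℕ-fromℕ< m<n) signed)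
        (eigen-combine {p = p} eig (eigen-translate {p = p} eig i) (sgn σ)) x

    localise : ∀ {v : Fun n} {x₀} → ¬ (v x₀ ≈ 0#) → IsEigenfunction μ p v → μ ≈ l
    localise {v} {x₀} v≉0 eig = difference≈0⇒≈
      (cancel-nonzero v≉0 (trans (*-comm _ _) (annihilate n {ε = λ _ → false} (ℕP.+-identityʳ n) (λ i ()) eig x₀)))

  signSum-weight : ∀ {n} (ε : Mask n) → ∑[ i < n ] sgn (ε i) + (fromℕ (weight ε) + fromℕ (weight ε)) ≈ fromℕ n
  signSum-weight {zero}  ε = trans (+-identityˡ _) (+-identityˡ 0#)
  signSum-weight {suc n} ε with ε zero | signSum-weight (ε ∘ suc)
  ... | false | IH = trans (solve 2 (λ s w → (con (+ 1) :+ s) :+ (w :+ w) := con (+ 1) :+ (s :+ (w :+ w))) refl _ _) (+-congˡ IH)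
  ... | true  | IH = trans (solve 2 (λ s w → (con -[1+ 0 ] :+ s) :+ ((con (+ 1) :+ w) :+ (con (+ 1) :+ w))
                                          := con (+ 1) :+ (s :+ (w :+ w))) refl _ _) (+-congˡ IH)

  charValue-formula : ∀ {n} p (ε : Mask n) {w s} → weight ε ≡ w → ⟨ ε · p ⟩ ≡ s →
    charValue p ε ≈ (fromℕ n + sgn s) + - (fromℕ w + fromℕ w)
  charValue-formula {n} p ε ≡.refl ≡.refl = begin
    S + t                            ≈⟨ solve 3 (λ S t W → S :+ t := ((S :+ W) :+ t) :- W) refl S t W ⟩
    ((S + W) + t) + - W              ≈⟨ +-congʳ (+-congʳ (signSum-weight ε)) ⟩
    (fromℕ n + t) + - W              ∎
    where
    S t W : Carrier
    S = ∑[ i < n ] sgn (ε i)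
    t = sgn ⟨ ε · p ⟩
    W = fromℕ (weight ε) + fromℕ (weight ε)

  trivial-character : ∀ {n} p (ε : Mask n) → weight ε ≡ 0 → charValue p ε ≈ 1# + fromℕ n
  trivial-character {n} p ε w≡0 = trans (charValue-formula p ε w≡0 (pairing-weight0 ε p w≡0))
    (solve 1 (λ N → (N :+ con (+ 1)) :- (con (+ 0) :+ con (+ 0)) := con (+ 1) :+ N) refl (fromℕ n))

  charValue-≤ : ∀ {n} p (ε : Mask n) t {j} → weight ε ≡ t ℕ.+ j →
    charValue p ε + (fromℕ t + fromℕ t) ≤ 1# + fromℕ n
  charValue-≤ {n} p ε t {j} w≡t+j =
    ≤-by (J + J + (1# + - s)) (0≤-+ (0≤-+ (0≤fromℕ j) (0≤fromℕ j)) (1-sgn ⟨ ε · p ⟩)) (begin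
    (charValue p ε + (T + T)) + (J + J + (1# + - s))
      ≈⟨ +-congʳ (+-congʳ (charValue-formula p ε w≡t+j ≡.refl)) ⟩
    (((N + s) + - (fromℕ (t ℕ.+ j) + fromℕ (t ℕ.+ j))) + (T + T)) + (J + J + (1# + - s))
      ≈⟨ +-congʳ (+-congʳ (+-congˡ (-‿cong (+-cong (fromℕ-+ t j) (fromℕ-+ t j))))) ⟩
    (((N + s) + - ((T + J) + (T + J))) + (T + T)) + (J + J + (1# + - s))
      ≈⟨ solve 4 (λ N s T J → (((N :+ s) :- ((T :+ J) :+ (T :+ J))) :+ (T :+ T)) :+ (J :+ J :+ (con (+ 1) :- s))
                              := con (+ 1) :+ N) refl N s T J ⟩
    1# + N ∎)
    where
    N s T J : Carrier
    N = fromℕ n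
    s = sgn ⟨ ε · p ⟩
    T = fromℕ t
    J = fromℕ j
    1-sgn : ∀ b → 0# ≤ 1# + - sgn b
    1-sgn false = ≤.reflexive (sym (-‿inverseʳ 1#))
    1-sgn true  = ≤.trans (0≤fromℕ 2) (≤.reflexive (solve 0 (con (+ 2) := con (+ 1) :- con -[1+ 0 ]) refl))

  separated-top : ∀ {n} (p : Mask n) μ → 1# + fromℕ n ≤ μ →
    ∀ ε → charValue p ε ≈ 1# + fromℕ n ⊎ ¬ (μ ≈ charValue p ε)
  separated-top {n} p μ n+1≤μ ε with weight ε in w≡
  ... | zero  = inj₁ (trivial-character p ε w≡)
  ... | suc j = inj₂ (apart (≤.trans (≤-shift _ (fromℕ 2) (charValue-≤ p ε 1 w≡)
          (solve 1 (λ N → (con (+ 1) :+ N) :+ (con (+ 2) :- ((con (+ 1) :+ con (+ 0)) :+ (con (+ 1) :+ con (+ 0))))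
                          := con (+ 1) :+ N) refl (fromℕ n))) n+1≤μ))

  separated-second : ∀ {n} (p : Mask (suc n)) μ → fromℕ n ≤ μ → ¬ (μ ≈ 1# + fromℕ (suc n)) →
    ∀ ε → charValue p ε ≈ fromℕ n ⊎ ¬ (μ ≈ charValue p ε)
  separated-second {n} p μ n≤μ μ≉top ε with weight ε in w≡
  ... | zero        = inj₂ λ μ≈c → μ≉top (trans μ≈c (trivial-character p ε w≡))
  ... | suc zero    = by-parity ⟨ ε · p ⟩ ≡.refl
    where
    by-parity : ∀ s → ⟨ ε · p ⟩ ≡ s → charValue p ε ≈ fromℕ n ⊎ ¬ (μ ≈ charValue p ε)
    by-parity false s≡ = inj₁ (trans (charValue-formula p ε w≡ s≡)
      (solve 1 (λ N → ((con (+ 1) :+ N) :+ con (+ 1)) :- ((con (+ 1) :+ con (+ 0)) :+ (con (+ 1) :+ con (+ 0))) := N)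
             refl (fromℕ n)))
    by-parity true  s≡ = inj₂ (apart (≤.trans (≤.reflexive (begin
      charValue p ε + fromℕ 2                                           ≈⟨ +-congʳ (charValue-formula p ε w≡ s≡) ⟩
      ((fromℕ (suc n) + sgn true) + - (fromℕ 1 + fromℕ 1)) + fromℕ 2
        ≈⟨ solve 1 (λ N → (((con (+ 1) :+ N) :+ con -[1+ 0 ]) :- ((con (+ 1) :+ con (+ 0)) :+ (con (+ 1) :+ con (+ 0))))
                          :+ con (+ 2) := N) refl (fromℕ n) ⟩
      fromℕ n                                                            ∎)) n≤μ))
  ... | suc (suc j) = inj₂ (apart (≤.trans (≤-shift _ (fromℕ 2) (charValue-≤ p ε 2 w≡)
          (solve 1 (λ N → (con (+ 1) :+ (con (+ 1) :+ N)) :+ (con (+ 2) :- (con (+ 2) :+ con (+ 2))) := N) refl (fromℕ n))) n≤μ))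

  separated-second-ones : ∀ {n} μ → fromℕ n + - fromℕ 3 ≤ μ → ¬ (μ ≈ 1# + fromℕ n) →
    ∀ (ε : Mask n) → charValue ones ε ≈ fromℕ n + - fromℕ 3 ⊎ ¬ (μ ≈ charValue ones ε)
  separated-second-ones {n} μ l≤μ μ≉top ε with weight ε in w≡
  ... | zero              = inj₂ λ μ≈c → μ≉top (trans μ≈c (trivial-character ones ε w≡))
  ... | suc zero          = inj₁ (trans (charValue-formula ones ε w≡ (≡.trans (pairing-ones ε) (≡.cong odd w≡)))
          (solve 1 (λ N → (N :+ con -[1+ 0 ]) :- ((con (+ 1) :+ con (+ 0)) :+ (con (+ 1) :+ con (+ 0))) := N :- con (+ 3))
                 refl (fromℕ n)))
  ... | suc (suc zero)    = inj₁ (trans (charValue-formula ones ε w≡ (≡.trans (pairing-ones ε) (≡.cong odd w≡)))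
          (solve 1 (λ N → (N :+ con (+ 1)) :- (con (+ 2) :+ con (+ 2)) := N :- con (+ 3)) refl (fromℕ n)))
  ... | suc (suc (suc j)) = inj₂ (apart (≤.trans (≤-shift _ (fromℕ 2) (charValue-≤ ones ε 3 w≡)
          (solve 1 (λ N → (con (+ 1) :+ N) :+ (con (+ 2) :- (con (+ 3) :+ con (+ 3))) := N :- con (+ 3)) refl (fromℕ n))) l≤μ))

  constant-eigen : ∀ {n} (p : Mask n) → IsEigenfunction (1# + fromℕ n) p (λ _ → 1#)
  constant-eigen {n} p x = trans (solve 1 (λ N → (con (+ 1) :+ N) :* con (+ 1) := N :* con (+ 1) :+ con (+ 1)) refl (fromℕ n))
                                 (+-congʳ (sym (neighbourSum-constant 1# x)))

  firstSign : ∀ {n} → Fun (suc n)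
  firstSign (b ∷ _) = sgn b

  firstSign-eigen : ∀ {n} (p : Mask (suc n)) → IsEigenfunction ((fromℕ n + - 1#) + sgn (p zero)) p firstSign
  firstSign-eigen {n} p (b ∷ y) = begin
    ((fromℕ n + - 1#) + sgn (p zero)) * sgn b
      ≈⟨ solve 3 (λ N t s → ((N :+ con -[1+ 0 ]) :+ t) :* s := (con -[1+ 0 ] :* s :+ N :* s) :+ t :* s)
               refl (fromℕ n) (sgn (p zero)) (sgn b) ⟩
    (- 1# * sgn b + fromℕ n * sgn b) + sgn (p zero) * sgn b
      ≈⟨ +-cong (+-cong (sgn-xor true b) (neighbourSum-constant (sgn b) y)) (sgn-xor (p zero) b) ⟨
    (sgn (not b) + neighbourSum (λ _ → sgn b) y) + sgn (p zero xor b) ∎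

module EnhancedHypercube {c ℓ₁ ℓ₂} (F : OrderedField c ℓ₁ ℓ₂)
                         (n k : ℕ) (1≤k : 1 ℕ.≤ k) (k≤n-1 : k ℕ.≤ n ∸ 1) where
  open OrderedField F hiding (zero)
  open OrderedFieldFacts F
  open CubeAnalysis F
  open Spectrum F n k

  true≢false : ¬ (true ≡ false)
  true≢false ()

  open import Relation.Binary.Reasoning.Setoid setoid

  p : Mask n
  p = twistMask k

  indicators : ∀ {a b a′ b′} → a ≡ a′ → b ≡ b′ → 𝟙 a + 𝟙 b ≈ 𝟙 a′ + 𝟙 b′
  indicators ≡.refl ≡.refl = refl

  twist-not-flip : ∀ {x y} → y ≡ x ⊕ p → oneFlipApart? x y ≡ false
  twist-not-flip {x} ≡.refl = ⊕-not-oneFlipApart p (twistMask-weight n k 1≤k k≤n-1) x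

  A-split : ∀ x y → A x y ≈ 𝟙 (oneFlipApart? x y) + 𝟙 (same? (x ⊕ p) y)
  A-split x y with adjacent? n k x y
  ... | yes (inj₁ (i , y≡)) = sym (trans (indicators flip-test not-twist) (+-identityʳ 1#))
    where
    flip-test : oneFlipApart? x y ≡ true
    flip-test = ≡.subst (λ z → oneFlipApart? x z ≡ true) (≡.sym y≡) (oneFlipApart?-complete i x)
    not-twist : same? (x ⊕ p) y ≡ false
    not-twist = ¬-not λ t → true≢false (≡.trans (≡.sym flip-test) (twist-not-flip {x} (≡.sym (same?-sound (x ⊕ p) y t))))
  ... | yes (inj₂ y≡) = sym (trans (indicators (twist-not-flip {x} y≡x⊕p) twist-test) (+-identityˡ 1#))
    where
    y≡x⊕p : y ≡ x ⊕ p
    y≡x⊕p = ≡.trans y≡ (twist≡⊕ k x)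
    twist-test : same? (x ⊕ p) y ≡ true
    twist-test = ≡.subst (λ z → same? (x ⊕ p) z ≡ true) (≡.sym y≡x⊕p) (same?-refl (x ⊕ p))
  ... | no ¬adjacent = sym (trans (indicators not-flip not-twist) (+-identityˡ 0#))
    where
    not-flip : oneFlipApart? x y ≡ false
    not-flip = ¬-not λ t → ¬adjacent (inj₁ (oneFlipApart?-sound x y t))
    not-twist : same? (x ⊕ p) y ≡ false
    not-twist = ¬-not λ t → ¬adjacent (inj₂ (≡.trans (≡.sym (same?-sound (x ⊕ p) y t)) (≡.sym (twist≡⊕ k x))))


  mulVec-split : ∀ v x → mulVec v x ≈ neighbourSum v x + v (x ⊕ p)
  mulVec-split v x = begin
    Σ⟨ allVertices n ⟩ (λ y → A x y * v y)
      ≈⟨ Σ-cong (allVertices n) (λ y → trans (*-congʳ (A-split x y)) (distribʳ _ _ _)) ⟩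
    Σ⟨ allVertices n ⟩ (λ y → flipPart y + twistPart y)
      ≈⟨ Σ-+ (allVertices n) flipPart twistPart ⟩
    Σ⟨ allVertices n ⟩ flipPart + Σ⟨ allVertices n ⟩ twistPart
      ≈⟨ +-cong (Σ-oneFlipApart? x v) (Σ-same? (x ⊕ p) v) ⟩
    neighbourSum v x + v (x ⊕ p) ∎
    where
    flipPart twistPart : Vertex n → Carrier
    flipPart  y = 𝟙 (oneFlipApart? x y) * v y
    twistPart y = 𝟙 (same? (x ⊕ p) y) * v y

  eigenvector⇒eigenfunction : ∀ {μ v} → (∀ x → mulVec v x ≈ μ * v x) → IsEigenfunction μ p v
  eigenvector⇒eigenfunction Av≈μv x = trans (sym (Av≈μv x)) (mulVec-split _ x)

  eigenfunction⇒eigenvalue : ∀ {μ v x₀} → ¬ (v x₀ ≈ 0#) → IsEigenfunction μ p v → IsEigenvalue μ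
  eigenfunction⇒eigenvalue {v = v} {x₀} v≉0 eig = v , (x₀ , v≉0) , λ x → trans (mulVec-split v x) (sym (eig x))

  eigenvalue-localised : ∀ {μ l} → (∀ ε → charValue p ε ≈ l ⊎ ¬ (μ ≈ charValue p ε)) → IsEigenvalue μ → μ ≈ l
  eigenvalue-localised {μ} {l} separated (v , (x₀ , v≉0) , Av≈μv) =
    Localisation.localise p μ l separated v≉0 (eigenvector⇒eigenfunction Av≈μv)

  λ₁ : Carrier
  λ₁ = 1# + fromℕ n

  largest : IsLargestEigenvalue λ₁
  largest = eigenfunction⇒eigenvalue {x₀ = replicate n false} nontrivial (constant-eigen p) , below-λ₁
    where
    below-λ₁ : ∀ μ → IsEigenvalue μ → μ ≤ λ₁
    below-λ₁ μ μ-eigen with ≤.total μ λ₁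
    ... | inj₁ μ≤λ₁ = μ≤λ₁
    ... | inj₂ λ₁≤μ = ≤.reflexive (eigenvalue-localised (separated-top p μ λ₁≤μ) μ-eigen)

  second-largest : ∀ l g → IsEigenvalue l → λ₁ + - l ≈ fromℕ (suc g) →
    (∀ μ → l ≤ μ → ¬ (μ ≈ λ₁) → ∀ ε → charValue p ε ≈ l ⊎ ¬ (μ ≈ charValue p ε)) →
    IsSecondLargestEigenvalue l × HasSpectralGap (fromℕ (suc g))
  second-largest l g l-eigen gap separated = second , (λ₁ , l , largest , second , gap)
    where
    below-l : ∀ μ → IsEigenvalue μ → ¬ (μ ≈ λ₁) → μ ≤ l
    below-l μ μ-eigen μ≉λ₁ with ≤.total μ l
    ... | inj₁ μ≤l = μ≤l
    ... | inj₂ l≤μ = ≤.reflexive (eigenvalue-localised (separated μ l≤μ μ≉λ₁) μ-eigen)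
    second : IsSecondLargestEigenvalue l
    second = λ₁ , largest , l-eigen , gap⇒≉ g gap , below-l

-- The theorem.  Both eigenvalue candidates come from the character
-- firstSign of the first unit vector, whose value is (n − 2) + (−1)^{p₁}
-- where p₁ = 0 for k ≥ 2 and p₁ = 1 for k = 1.

corollary2 : ∀ {c ℓ₁ ℓ₂} (F : OrderedField c ℓ₁ ℓ₂) (n : ℕ) → 2 ℕ.≤ n →
    ((k : ℕ) → 2 ℕ.≤ k → k ℕ.≤ n ∸ 1 →
      Spectrum.IsSecondLargestEigenvalue F n k (OrderedField.fromℕ F (n ∸ 1))
      × Spectrum.HasSpectralGap F n k (OrderedField.fromℕ F 2))
    × (Spectrum.IsSecondLargestEigenvalue F n 1
         (OrderedField._+_ F (OrderedField.fromℕ F n) (OrderedField.-_ F (OrderedField.fromℕ F 3)))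
       × Spectrum.HasSpectralGap F n 1 (OrderedField.fromℕ F 4))
corollary2 F n@(suc (suc m)) (ℕ.s≤s (ℕ.s≤s _)) = k≥2 , k≡1
  where
  open OrderedField F hiding (zero)
  open OrderedFieldFacts F
  open CubeAnalysis F
  origin : Vertex n
  origin = replicate n false

  k≥2 : (k : ℕ) → 2 ℕ.≤ k → k ℕ.≤ n ∸ 1 →
    Spectrum.IsSecondLargestEigenvalue F n k (fromℕ (suc m)) × Spectrum.HasSpectralGap F n k (fromℕ 2)
  k≥2 k@(suc (suc _)) (ℕ.s≤s (ℕ.s≤s _)) k≤n-1 = second-largest (fromℕ (suc m)) 1 n-1-eigen gap (separated-second p)
    where
    open EnhancedHypercube F n k (ℕ.s≤s ℕ.z≤n) k≤n-1
    -- p₁ = 0, so firstSign has eigenvalue (n − 2) + 1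
    n-1-eigen : Spectrum.IsEigenvalue F n k (fromℕ (suc m))
    n-1-eigen = eigenfunction⇒eigenvalue {x₀ = origin} nontrivial (eigen-resp {p = p}
      (solve 1 (λ N → (N :- con (+ 1)) :+ con (+ 1) := N) refl (fromℕ (suc m))) (firstSign-eigen p))
    gap : λ₁ + - fromℕ (suc m) ≈ fromℕ 2
    gap = solve 1 (λ N → (con (+ 1) :+ (con (+ 1) :+ N)) :- N := con (+ 2)) refl (fromℕ (suc m))

  k≡1 : Spectrum.IsSecondLargestEigenvalue F n 1 (fromℕ n + - fromℕ 3) × Spectrum.HasSpectralGap F n 1 (fromℕ 4)
  k≡1 = second-largest (fromℕ n + - fromℕ 3) 3 n-3-eigen gap separated-second-ones
    where
    open EnhancedHypercube F n 1 (ℕ.s≤s ℕ.z≤n) (ℕ.s≤s ℕ.z≤n)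
    -- p₁ = 1, so firstSign has eigenvalue (n − 2) − 1
    n-3-eigen : Spectrum.IsEigenvalue F n 1 (fromℕ n + - fromℕ 3)
    n-3-eigen = eigenfunction⇒eigenvalue {x₀ = origin} nontrivial (eigen-resp {p = p}
      (solve 1 (λ N → (N :- con (+ 1)) :+ con -[1+ 0 ] := (con (+ 1) :+ N) :- con (+ 3)) refl (fromℕ (suc m)))
      (firstSign-eigen p))
    gap : λ₁ + - (fromℕ n + - fromℕ 3) ≈ fromℕ 4
    gap = solve 1 (λ N → (con (+ 1) :+ N) :- (N :- con (+ 3)) := con (+ 4)) refl (fromℕ n)
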